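{- For every integer $s\ge0$, the following identity of formal power series in $u$ holds: $$\sum_{n\ge0}u^n\sum_{\binom{c}{w}\in\mathrm{WSP}_n(s)}q^{\mathrm{tot}\,c}Z^{\mathrm{neg}\,w}=\Bigl(1-u\sum_{i=0}^s q^iZ^{\chi(i\ \mathrm{odd})}\Bigr)^{ -1}.$$
   Context: $\chi(A)=1$ if statement $A$ is true and $0$ otherwise. For a word $c=c_1\cdots c_n$, $\mathrm{tot}\,c=c_1+\cdots+c_n$. $B_n$ is the set of signed permutations $w=x_1\cdots x_n$ ($x_i\in\{\pm1,\dots,\pm n\}$, $|x_1|\cdots|x_n|$ a permutation of $1\cdots n$); $\mathrm{neg}\,w$ is its number of negative letters. A weighted signed permutation of order $n$ is a pair $\binom{c}{w}$ where $c=c_1\cdots c_n$ is a nonincreasing word of nonnegative integers, $w=x_1\cdots x_n\in B_n$, $c_k=c_{k+1}\Rightarrow x_k<x_{k+1}$ for $1\le k<n$, and $x_k>0$ if $c_k$ is even, $x_k<0$ if $c_k$ is odd. $\mathrm{WSP}_n(s)$ is the set of weighted signed permutations of order $n$ with $c_1\le s$ (for $n=0$, the empty pair). -}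

module Defs where

open import Level using (Level)
open import Data.Bool using (Bool; true; false; if_then_else_)
open import Data.Nat as ℕ using (ℕ; zero; suc; _≤_; _%_; _≡ᵇ_)
import Data.Nat.Properties as ℕP
open import Data.Nat.ListAction using (sum)
open import Data.Integer as ℤ using (ℤ; +_; -_; ∣_∣; _<_)
import Data.Integer.Properties as ℤP
open import Data.List using (List; []; _∷_; length; map; concatMap; upTo; filter; zip; cartesianProduct; foldr; _++_)
open import Data.List.Relation.Unary.All using (All; all?)
open import Data.List.Relation.Unary.Linked using (Linked; linked?)
open import Data.List.Relation.Unary.AllPairs using (allPairs?)
open import Data.List.Relation.Unary.Unique.Propositional using (Unique)
open import Data.Product using (_×_; _,_; proj₁; proj₂; uncurry)

open import Data.Unit using (⊤; tt)
open import Relation.Binary.PropositionalEquality using (_≡_)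
open import Relation.Nullary using (Dec; yes; no; ¬?; ¬_)
open import Relation.Nullary.Decidable using (_×-dec_; _→-dec_)
open import Algebra.Bundles using (CommutativeRing)

tot : List ℕ → ℕ
tot = sum

neg : List ℤ → ℕ
neg w = length (filter (λ x → x ℤ.<? + 0) w)

words : {A : Set} → List A → ℕ → List (List A)
words L zero    = [] ∷ []
words L (suc n) = concatMap (λ a → map (a ∷_) (words L n)) L

-- Signed permutations: w = x₁⋯xₙ ∈ ℤⁿ with |x₁|⋯|xₙ| a permutation of
-- 1⋯n (in one-line notation: n distinct letters from {1,…,n}).

InRange : ℕ → ℤ → Set
InRange n x = (1 ℕ.≤ ∣ x ∣) × (∣ x ∣ ℕ.≤ n)

IsSignedPerm : ℕ → List ℤ → Set
IsSignedPerm n w = (length w ≡ n) × All (InRange n) w × Unique (map ∣_∣ w)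

HeadLe : ℕ → List ℕ → Set
HeadLe s []      = ⊤
HeadLe s (c ∷ _) = c ≤ s

AdjOK : ℕ × ℤ → ℕ × ℤ → Set
AdjOK (c , x) (c′ , x′) = c ≡ c′ → x < x′

SignOK : ℕ × ℤ → Set
SignOK (c , x) = if c % 2 ≡ᵇ 0 then (+ 0 < x) else (x < + 0)

IsWSP : ℕ → ℕ → List ℕ → List ℤ → Set
IsWSP n s c w =
  (length c ≡ n) × Linked ℕ._≥_ c × HeadLe s c × IsSignedPerm n w
  × Linked AdjOK (zip c w) × All SignOK (zip c w)

headLe? : ∀ s c → Dec (HeadLe s c)
headLe? s []      = yes tt
headLe? s (c ∷ _) = c ℕ.≤? s

adjOK? : ∀ p p′ → Dec (AdjOK p p′)
adjOK? (c , x) (c′ , x′) = (c ℕ.≟ c′) →-dec (x ℤ.<? x′)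

signOK? : ∀ p → Dec (SignOK p)
signOK? (c , x) with c % 2 ≡ᵇ 0
... | true  = + 0 ℤ.<? x
... | false = x ℤ.<? + 0

inRange? : ∀ n x → Dec (InRange n x)
inRange? n x = (1 ℕ.≤? ∣ x ∣) ×-dec (∣ x ∣ ℕ.≤? n)

isWSP? : ∀ n s c w → Dec (IsWSP n s c w)
isWSP? n s c w =
  (length c ℕ.≟ n) ×-dec linked? (λ a b → b ℕ.≤? a) c ×-dec headLe? s c
  ×-dec ((length w ℕ.≟ n) ×-dec all? (inRange? n) w
          ×-dec allPairs? (λ a b → ¬? (a ℕ.≟ b)) (map ∣_∣ w))
  ×-dec linked? adjOK? (zip c w) ×-dec all? signOK? (zip c w)

-- A finite superset of the possible rows c (entries in {0,…,s}, which
-- is forced by c nonincreasing with c₁ ≤ s) and of B_n (letters in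
-- {±1,…,±n}).
rowCandidates : ℕ → ℕ → List (List ℕ)
rowCandidates n s = words (upTo (suc s)) n

signedLetters : ℕ → List ℤ
signedLetters n = map (λ k → + suc k) (upTo n) ++ map (λ k → - (+ suc k)) (upTo n)

WSP : ℕ → ℕ → List (List ℕ × List ℤ)
WSP n s = filter (λ p → isWSP? n s (proj₁ p) (proj₂ p))
                 (cartesianProduct (rowCandidates n s) (words (signedLetters n) n))

module _ {a ℓ : Level} (R : CommutativeRing a ℓ) where
  open CommutativeRing R

  pow : Carrier → ℕ → Carrier
  pow x zero    = 1#
  pow x (suc k) = x * pow x k

  ringSum : List Carrier → Carrier
  ringSum = foldr _+_ 0#

  -- Σ_{(c,w) ∈ WSPₙ(s)} q^{tot c} Z^{neg w}   (coefficient of uⁿ on the left)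
  wspGF : Carrier → Carrier → ℕ → ℕ → Carrier
  wspGF q Z n s = ringSum (map (λ p → pow q (tot (proj₁ p)) * pow Z (neg (proj₂ p))) (WSP n s))

  stepSum : Carrier → Carrier → ℕ → Carrier
  stepSum q Z s = ringSum (map (λ i → pow q i * pow Z (i % 2)) (upTo (suc s)))

-- Write the columns (c_k , x_k) of a weighted signed permutation of order n+1 as a list;
-- the conditions on c and w say that this list is strictly increasing for the order ≺
-- (weight decreasing, then letter increasing). Removing the column of the letter ±(n+1),
-- whose sign is forced by the parity of its weight i ≤ s, and re-inserting it at its
-- sorted place are mutually inverse, so WSPₙ₊₁(s) is in bijection with {0,…,s} × WSPₙ(s).
-- The removed column contributes the factor q^i Z^{χ(i odd)} to q^{tot c} Z^{neg w}, hence
-- the coefficient of u^{n+1} is stepSum times the coefficient of uⁿ, while WSP₀(s) is the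
-- single empty pair.

module Submission where

open import Level using (Level; 0ℓ)
open import Function using (_∘_; flip)
open import Function.Bundles using (mk⇔)
open import Data.Bool using (if_then_else_)
open import Data.Empty using (⊥; ⊥-elim)
open import Data.Sum using (inj₁; inj₂)
open import Data.Product using (_×_; _,_; proj₁; proj₂; uncurry)
import Data.Product as Product
open import Data.Product.Relation.Binary.Lex.Strict using (×-Lex; ×-transitive; ×-compare)
open import Data.Product.Relation.Binary.Pointwise.NonDependent using (≡×≡⇒≡; ≡⇒≡×≡)
open import Data.Nat as ℕ using (ℕ; zero; suc; _≤_; _<_; _%_; _≡ᵇ_; z≤n; s≤s; s≤s⁻¹)
import Data.Nat.Properties as ℕP
open import Data.Nat.DivMod using (m%n<n)
open import Data.Nat.ListAction.Properties using (sum-↭)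
open import Data.Integer as ℤ using (ℤ; +_; -_; -[1+_]; ∣_∣)
import Data.Integer.Properties as ℤP
open import Data.List using (List; []; _∷_; _++_; length; map; upTo; zip; unzip; cartesianProduct; cartesianProductWith; concatMap)
open import Data.List.Properties using (∷-injective; length-map; length-upTo; map-++; map-∘; unzip-zip; zip-unzip)
open import Data.List.Membership.Propositional using (_∈_; _∉_; find)
open import Data.List.Membership.Propositional.Properties
  using (∈-∃++; ∈-map⁺; ∈-map⁻; ∈-upTo⁺; ∈-upTo⁻; ∈-++⁺ˡ; ∈-++⁺ʳ; ∈-filter⁺; ∈-filter⁻;
         ∈-cartesianProductWith⁺; ∈-cartesianProduct⁺; ∈-cartesianProduct⁻)
open import Data.List.Membership.Propositional.Properties.WithK using (unique∧set⇒bag)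
open import Data.List.Relation.Binary.BagAndSetEquality using (∼bag⇒↭)
open import Data.List.Relation.Binary.Pointwise using (Pointwise-≡⇒≡)
open import Data.List.Relation.Binary.Subset.Propositional using (_⊆_)
open import Data.List.Relation.Binary.Permutation.Propositional
  using (_↭_; ↭-sym; ↭-trans; prep; ↭⇒↭ₛ; ↭⇒↭ₛ′; module PermutationReasoning)
import Data.List.Relation.Binary.Permutation.Propositional.Properties as Perm
open Perm using (All-resp-↭; ↭-length; ∈-resp-↭; shift; drop-∷)
import Data.List.Relation.Binary.Permutation.Setoid.Properties as Permₛ
open import Data.List.Relation.Unary.All as All using (All; []; _∷_)
import Data.List.Relation.Unary.All.Properties as Allₚ
open import Data.List.Relation.Unary.AllPairs using ([]; _∷_)
open import Data.List.Relation.Unary.Any as Any using (Any; here; there; any?)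
import Data.List.Relation.Unary.Any.Properties as Anyₚ
open import Data.List.Relation.Unary.Linked as Linked using (Linked; []; _∷_)
import Data.List.Relation.Unary.Linked.Properties as Linkedₚ
open import Data.List.Relation.Unary.Unique.Propositional using (Unique)
import Data.List.Relation.Unary.Unique.Propositional.Properties as Unique
open import Relation.Binary using (Rel; tri<; tri≈; tri>; Trichotomous; IsStrictTotalOrder; DecTotalOrder)
open import Relation.Binary.Structures.Biased using (isStrictTotalOrderᶜ)
import Relation.Binary.Construct.Flip.EqAndOrd as Flip
import Relation.Binary.Construct.StrictToNonStrict as StrictToNonStrict
open import Relation.Binary.PropositionalEquality as ≡ using (_≡_; _≢_; refl)
open import Relation.Nullary using (yes; no; contradiction)
open import Algebra.Bundles using (CommutativeRing)

open import Defs

Unique-resp-↭ : {A : Set} {xs ys : List A} → xs ↭ ys → Unique xs → Unique ys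
Unique-resp-↭ {A} p = Permₛ.Unique-resp-↭ (≡.setoid A) (↭⇒↭ₛ p)

Unique-map⁺-∈ : {A B : Set} {f : A → B} {xs : List A} →
  (∀ {x y} → x ∈ xs → y ∈ xs → f x ≡ f y → x ≡ y) → Unique xs → Unique (map f xs)
Unique-map⁺-∈ {xs = []}     inj []         = []
Unique-map⁺-∈ {xs = x ∷ xs} inj (x∉ ∷ uxs) =
  Allₚ.map⁺ (All.tabulate (λ y∈ fx≡fy → All.lookup x∉ y∈ (inj (here refl) (there y∈) fx≡fy)))
  ∷ Unique-map⁺-∈ (λ x∈ y∈ → inj (there x∈) (there y∈)) uxs

unique∧⊆⇒length≤ : {A : Set} {xs ys : List A} → Unique xs → xs ⊆ ys → length xs ≤ length ys
unique∧⊆⇒length≤ {xs = []}     _          _  = z≤n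
unique∧⊆⇒length≤ {xs = x ∷ xs} (x∉ ∷ uxs) xs⊆ys
  with as , bs , refl ← ∈-∃++ (xs⊆ys (here refl)) =
  ℕP.≤-trans (s≤s (unique∧⊆⇒length≤ uxs xs⊆as++bs)) (ℕP.≤-reflexive (≡.sym (↭-length (shift x as bs))))
  where
  xs⊆as++bs : xs ⊆ as ++ bs
  xs⊆as++bs {y} y∈xs with ∈-resp-↭ (shift x as bs) (xs⊆ys (there y∈xs))
  ... | here y≡x   = ⊥-elim (All.lookup x∉ y∈xs (≡.sym y≡x))
  ... | there y∈as++bs = y∈as++bs

unzip≡map-proj : {A B : Set} (ps : List (A × B)) → unzip ps ≡ (map proj₁ ps , map proj₂ ps)
unzip≡map-proj []       = refl
unzip≡map-proj (p ∷ ps) = ≡.cong (Product.map (proj₁ p ∷_) (proj₂ p ∷_)) (unzip≡map-proj ps)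

zip-map-proj : {A B : Set} (ps : List (A × B)) → zip (map proj₁ ps) (map proj₂ ps) ≡ ps
zip-map-proj ps = ≡.trans (≡.cong (uncurry zip) (≡.sym (unzip≡map-proj ps))) (zip-unzip ps)

map-proj-zip : {A B : Set} {xs : List A} {ys : List B} → length xs ≡ length ys →
  map proj₁ (zip xs ys) ≡ xs × map proj₂ (zip xs ys) ≡ ys
map-proj-zip {xs = xs} {ys} |xs|≡|ys| = ≡.cong proj₁ zipped , ≡.cong proj₂ zipped
  where zipped = ≡.trans (≡.sym (unzip≡map-proj (zip xs ys))) (unzip-zip xs ys |xs|≡|ys|)

unzip-injective : {A B : Set} {xs ys : List (A × B)} → unzip xs ≡ unzip ys → xs ≡ ys
unzip-injective {xs = xs} {ys} eq =
  ≡.trans (≡.sym (zip-unzip xs)) (≡.trans (≡.cong (uncurry zip) eq) (zip-unzip ys))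

unzip-↭ : {A B : Set} {xs ys : List (A × B)} → xs ↭ ys →
  proj₁ (unzip xs) ↭ proj₁ (unzip ys) × proj₂ (unzip xs) ↭ proj₂ (unzip ys)
unzip-↭ {xs = xs} {ys} xs↭ys rewrite unzip≡map-proj xs | unzip≡map-proj ys =
  Perm.map⁺ proj₁ xs↭ys , Perm.map⁺ proj₂ xs↭ys

concatMap-∷≡cartesianProductWith : {A : Set} (xs : List A) (yss : List (List A)) →
  concatMap (λ x → map (x ∷_) yss) xs ≡ cartesianProductWith _∷_ xs yss
concatMap-∷≡cartesianProductWith []       yss = refl
concatMap-∷≡cartesianProductWith (x ∷ xs) yss =
  ≡.cong (map (x ∷_) yss ++_) (concatMap-∷≡cartesianProductWith xs yss)

words-unique : {A : Set} {L : List A} (n : ℕ) → Unique L → Unique (words L n)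
words-unique zero    uL = [] ∷ []
words-unique {L = L} (suc n) uL
  rewrite concatMap-∷≡cartesianProductWith L (words L n) =
  Unique.cartesianProductWith⁺ _∷_ ∷-injective uL (words-unique n uL)

∈-words⁺ : {A : Set} {L : List A} {n : ℕ} {xs : List A} → length xs ≡ n → All (_∈ L) xs → xs ∈ words L n
∈-words⁺ {n = zero}  {[]}     refl []         = here refl
∈-words⁺ {L = L} {n = suc n} {x ∷ xs} refl (x∈ ∷ xs∈)
  rewrite concatMap-∷≡cartesianProductWith L (words L n) =
  ∈-cartesianProductWith⁺ _∷_ x∈ (∈-words⁺ refl xs∈)

module RingSums {a ℓ : Level} (R : CommutativeRing a ℓ) where
  open CommutativeRing R renaming (refl to ≈-refl)
  open import Relation.Binary.Reasoning.Setoid setoid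

  pow-homo-* : ∀ x m n → pow R x (m ℕ.+ n) ≈ pow R x m * pow R x n
  pow-homo-* x zero    n = sym (*-identityˡ _)
  pow-homo-* x (suc m) n = trans (*-congˡ (pow-homo-* x m n)) (sym (*-assoc _ _ _))

  ringSum-resp-↭ : {xs ys : List Carrier} → xs ↭ ys → ringSum R xs ≈ ringSum R ys
  ringSum-resp-↭ p = Permₛ.foldr-commMonoid setoid +-isCommutativeMonoid (↭⇒↭ₛ′ isEquivalence p)

  ringSum-++ : (xs ys : List Carrier) → ringSum R (xs ++ ys) ≈ ringSum R xs + ringSum R ys
  ringSum-++ []       ys = sym (+-identityˡ _)
  ringSum-++ (x ∷ xs) ys = trans (+-congˡ (ringSum-++ xs ys)) (sym (+-assoc _ _ _))

  ringSum-map-cong : {A : Set} {f g : A → Carrier} (xs : List A) →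
    (∀ {x} → x ∈ xs → f x ≈ g x) → ringSum R (map f xs) ≈ ringSum R (map g xs)
  ringSum-map-cong []       f≈g = ≈-refl
  ringSum-map-cong (x ∷ xs) f≈g = +-cong (f≈g (here refl)) (ringSum-map-cong xs (f≈g ∘ there))

  ringSum-*ˡ : {A : Set} (c : Carrier) (f : A → Carrier) (xs : List A) →
    ringSum R (map (λ x → c * f x) xs) ≈ c * ringSum R (map f xs)
  ringSum-*ˡ c f []       = sym (zeroʳ c)
  ringSum-*ˡ c f (x ∷ xs) = trans (+-congˡ (ringSum-*ˡ c f xs)) (sym (distribˡ c _ _))

  ringSum-cartesianProduct : {A B : Set} (f : A → Carrier) (g : B → Carrier) (xs : List A) (ys : List B) →
    ringSum R (map (λ p → f (proj₁ p) * g (proj₂ p)) (cartesianProduct xs ys))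
      ≈ ringSum R (map f xs) * ringSum R (map g ys)
  ringSum-cartesianProduct f g []       ys = sym (zeroˡ _)
  ringSum-cartesianProduct f g (x ∷ xs) ys = begin
    ringSum R (map h (map (x ,_) ys ++ cartesianProduct xs ys))
      ≡⟨ ≡.cong (ringSum R) (map-++ h (map (x ,_) ys) _) ⟩
    ringSum R (map h (map (x ,_) ys) ++ map h (cartesianProduct xs ys))
      ≈⟨ ringSum-++ (map h (map (x ,_) ys)) _ ⟩
    ringSum R (map h (map (x ,_) ys)) + ringSum R (map h (cartesianProduct xs ys))
      ≡⟨ ≡.cong (λ zs → ringSum R zs + ringSum R (map h (cartesianProduct xs ys)))
                (≡.sym (map-∘ ys)) ⟩
    ringSum R (map (λ y → f x * g y) ys) + ringSum R (map h (cartesianProduct xs ys))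
      ≈⟨ +-cong (ringSum-*ˡ (f x) g ys) (ringSum-cartesianProduct f g xs ys) ⟩
    f x * ringSum R (map g ys) + ringSum R (map f xs) * ringSum R (map g ys)
      ≈⟨ sym (distribʳ _ _ _) ⟩
    ringSum R (map f (x ∷ xs)) * ringSum R (map g ys) ∎
    where
    h : _ × _ → Carrier
    h p = f (proj₁ p) * g (proj₂ p)

Column : Set
Column = ℕ × ℤ

_≺_ : Rel Column 0ℓ
_≺_ = ×-Lex _≡_ ℕ._>_ ℤ._<_

≺-compare : Trichotomous _≡_ _≺_
≺-compare p q with ×-compare ≡.sym (Flip.compare ℕ._<_ ℕP.<-cmp) ℤP.<-cmp p q
... | tri< p≺q p≢q q⊀p = tri< p≺q (p≢q ∘ ≡⇒≡×≡) q⊀p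
... | tri≈ p⊀q p≡q q⊀p = tri≈ p⊀q (≡×≡⇒≡ p≡q) q⊀p
... | tri> p⊀q p≢q q≺p = tri> p⊀q (p≢q ∘ ≡⇒≡×≡) q≺p

≺-isStrictTotalOrder : IsStrictTotalOrder _≡_ _≺_
≺-isStrictTotalOrder = isStrictTotalOrderᶜ record
  { isEquivalence = ≡.isEquivalence
  ; trans         = ×-transitive {_<₁_ = ℕ._>_} {_<₂_ = ℤ._<_}
                      ≡.isEquivalence (≡.resp₂ ℕ._>_) (flip ℕP.<-trans) ℤP.<-trans
  ; compare       = ≺-compare
  }

open StrictToNonStrict _≡_ _≺_ using () renaming (_≤_ to _≼_)

≼-decTotalOrder : DecTotalOrder 0ℓ 0ℓ 0ℓ
≼-decTotalOrder = record
  { isDecTotalOrder = StrictToNonStrict.isDecTotalOrder _≡_ _≺_ ≺-isStrictTotalOrder }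

open import Data.List.Relation.Unary.Sorted.TotalOrder (DecTotalOrder.totalOrder ≼-decTotalOrder) using (Sorted)
open import Data.List.Relation.Unary.Sorted.TotalOrder.Properties using (↗↭↗⇒≋)

sorted-↭⇒≡ : {xs ys : List Column} → Sorted xs → Sorted ys → xs ↭ ys → xs ≡ ys
sorted-↭⇒≡ xs↗ ys↗ xs↭ys = Pointwise-≡⇒≡
  (↗↭↗⇒≋ (DecTotalOrder.totalOrder ≼-decTotalOrder) xs↗ ys↗ (↭⇒↭ₛ′ ≡.isEquivalence xs↭ys))

sorted∧unique⇒linked-≺ : {xs : List Column} → Sorted xs → Unique xs → Linked _≺_ xs
sorted∧unique⇒linked-≺ xs↗ uxs = Linked.zipWith ≼∧≢⇒≺ (xs↗ , Linkedₚ.AllPairs⇒Linked uxs)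
  where
  ≼∧≢⇒≺ : ∀ {p q} → p ≼ q × p ≢ q → p ≺ q
  ≼∧≢⇒≺ (inj₁ p≺q  , _)   = p≺q
  ≼∧≢⇒≺ (inj₂ p≡q , p≢q) = contradiction p≡q p≢q

open import Data.List.Sort.InsertionSort.Base ≼-decTotalOrder using (insert; sort)
open import Data.List.Sort.InsertionSort.Properties ≼-decTotalOrder using (insert-↭; insert-↗; sort-↭; sort-↗)

signedLetters-unique : ∀ n → Unique (signedLetters n)
signedLetters-unique n =
  Unique.++⁺ (Unique.map⁺ +suc-injective (Unique.upTo⁺ n))
             (Unique.map⁺ -suc-injective (Unique.upTo⁺ n)) disjoint
  where
  +suc-injective : ∀ {a b} → + suc a ≡ + suc b → a ≡ b
  +suc-injective refl = refl
  -suc-injective : ∀ {a b} → - (+ suc a) ≡ - (+ suc b) → a ≡ b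
  -suc-injective refl = refl
  disjoint : ∀ {x} → x ∈ map (λ k → + suc k) (upTo n) × x ∈ map (λ k → - (+ suc k)) (upTo n) → ⊥
  disjoint (x∈₁ , x∈₂) with ∈-map⁻ (λ k → + suc k) x∈₁ | ∈-map⁻ (λ k → - (+ suc k)) x∈₂
  ... | _ , _ , refl | _ , _ , ()

∈-signedLetters⁺ : ∀ {n x} → InRange n x → x ∈ signedLetters n
∈-signedLetters⁺ {n} {+ suc k}  (_ , k<n) = ∈-++⁺ˡ (∈-map⁺ (λ k → + suc k) (∈-upTo⁺ k<n))
∈-signedLetters⁺ {n} { -[1+ k ]} (_ , k<n) =
  ∈-++⁺ʳ (map (λ k → + suc k) (upTo n)) (∈-map⁺ (λ k → - (+ suc k)) (∈-upTo⁺ k<n))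

headLe⇒all≤ : ∀ {s c} → HeadLe s c → Linked ℕ._≥_ c → All (_≤ s) c
headLe⇒all≤ {c = []}         _   _           = []
headLe⇒all≤ {c = _ ∷ []}     c≤s _           = c≤s ∷ []
headLe⇒all≤ {c = _ ∷ _ ∷ _}  c≤s (c≥c′ ∷ cs) = c≤s ∷ headLe⇒all≤ (ℕP.≤-trans c≥c′ c≤s) cs

WSP-unique : ∀ n s → Unique (WSP n s)
WSP-unique n s = Unique.filter⁺ _
  (Unique.cartesianProduct⁺ (words-unique n (Unique.upTo⁺ (suc s)))
                            (words-unique n (signedLetters-unique n)))

∈-WSP⁻ : ∀ {n s c w} → (c , w) ∈ WSP n s → IsWSP n s c w
∈-WSP⁻ {n} {s} cw∈ = proj₂ (∈-filter⁻ (λ p → isWSP? n s (proj₁ p) (proj₂ p))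
  {xs = cartesianProduct (rowCandidates n s) (words (signedLetters n) n)} cw∈)

∈-WSP⁺ : ∀ {n s c w} → IsWSP n s c w → (c , w) ∈ WSP n s
∈-WSP⁺ wsp@(|c| , c↘ , c₁≤s , (|w| , w∈ , _) , _) = ∈-filter⁺ _
  (∈-cartesianProduct⁺ (∈-words⁺ |c| (All.map (λ c≤s → ∈-upTo⁺ (s≤s c≤s)) (headLe⇒all≤ c₁≤s c↘)))
                       (∈-words⁺ |w| (All.map ∈-signedLetters⁺ w∈)))
  wsp

WSP-unzip-zip : ∀ {n s c w} → (c , w) ∈ WSP n s → unzip (zip c w) ≡ (c , w)
WSP-unzip-zip {n} {s} {c} {w} cw∈ with ∈-WSP⁻ {n} {s} cw∈
... | |c| , _ , _ , (|w| , _) , _ = unzip-zip c w (≡.trans |c| (≡.sym |w|))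

IsSignedPerm-resp-↭ : ∀ {n w w′} → w ↭ w′ → IsSignedPerm n w → IsSignedPerm n w′
IsSignedPerm-resp-↭ w↭w′ (|w| , w∈ , uw) =
  ≡.trans (≡.sym (↭-length w↭w′)) |w| , All-resp-↭ w↭w′ w∈ , Unique-resp-↭ (Perm.map⁺ ∣_∣ w↭w′) uw

IsSignedPerm-∷ : ∀ {n x w} → ∣ x ∣ ≡ suc n → IsSignedPerm n w → IsSignedPerm (suc n) (x ∷ w)
IsSignedPerm-∷ {n} {x} ∣x∣≡ (|w| , w∈ , uw) =
  ≡.cong suc |w| , x∈ ∷ All.map (λ {y} → weaken {y}) w∈ , Allₚ.map⁺ (All.map (λ {y} → x≢ {y}) w∈) ∷ uw
  where
  x∈ : InRange (suc n) x
  x∈ = ≡.subst (λ k → 1 ≤ k × k ≤ suc n) (≡.sym ∣x∣≡) (s≤s z≤n , ℕP.≤-refl)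
  weaken : ∀ {y} → InRange n y → InRange (suc n) y
  weaken (1≤ , ≤n) = 1≤ , ℕP.m≤n⇒m≤1+n ≤n
  x≢ : ∀ {y} → InRange n y → ∣ x ∣ ≢ ∣ y ∣
  x≢ (_ , ≤n) ∣x∣≡∣y∣ = ℕP.1+n≰n (≡.subst (_≤ n) (≡.trans (≡.sym ∣x∣≡∣y∣) ∣x∣≡) ≤n)

IsSignedPerm-∷⁻ : ∀ {n x w} → ∣ x ∣ ≡ suc n → IsSignedPerm (suc n) (x ∷ w) → IsSignedPerm n w
IsSignedPerm-∷⁻ ∣x∣≡ (|w| , _ ∷ w∈ , x∉ ∷ uw) =
  ℕP.suc-injective |w| ,
  All.zipWith (λ ((1≤ , ≤1+n) , x≢) → 1≤ , s≤s⁻¹ (ℕP.≤∧≢⇒< ≤1+n (x≢ ∘ ≡.trans ∣x∣≡ ∘ ≡.sym)))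
              (w∈ , Allₚ.map⁻ x∉) ,
  uw

-- Otherwise the n+1 distinct values ∣ x ∣ would all lie in {1,…,n}.
IsSignedPerm⇒top : ∀ {n w} → IsSignedPerm (suc n) w → Any (λ x → ∣ x ∣ ≡ suc n) w
IsSignedPerm⇒top {n} {w} (|w| , w∈ , uw) with any? (λ x → ∣ x ∣ ℕP.≟ suc n) w
... | yes top = top
... | no ¬top = contradiction (unique∧⊆⇒length≤ uw |w|⊆[1,n]) (ℕP.<⇒≱ (ℕP.≤-reflexive (≡.sym lengths)))
  where
  lengths : length (map ∣_∣ w) ≡ suc (length (map suc (upTo n)))
  lengths = ≡.trans (length-map ∣_∣ w)
              (≡.trans |w| (≡.cong suc (≡.sym (≡.trans (length-map suc (upTo n)) (length-upTo n)))))
  ∈[1,n] : ∀ {k} → 1 ≤ k × k ≤ n → k ∈ map suc (upTo n)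
  ∈[1,n] {suc k} (_ , k<n) = ∈-map⁺ suc (∈-upTo⁺ k<n)
  |w|⊆[1,n] : ∀ {k} → k ∈ map ∣_∣ w → k ∈ map suc (upTo n)
  |w|⊆[1,n] k∈ with find (Anyₚ.map⁻ k∈)
  ... | x , x∈w , refl with All.lookup w∈ x∈w
  ...   | 1≤ , ≤1+n =
    ∈[1,n] (1≤ , s≤s⁻¹ (ℕP.≤∧≢⇒< ≤1+n (λ ∣x∣≡ → ¬top (Any.map (λ { refl → ∣x∣≡ }) x∈w))))

parityLetter : ℕ → ℕ → ℤ
parityLetter zero    k = + k
parityLetter (suc _) k = - + k

topColumn : ℕ → ℕ → Column
topColumn n i = i , parityLetter (i % 2) (suc n)

∣parityLetter∣ : ∀ m k → ∣ parityLetter m (suc k) ∣ ≡ suc k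
∣parityLetter∣ zero    k = refl
∣parityLetter∣ (suc _) k = refl

-- SignOK (i , x) is ParitySign (i % 2) x by definition; abstracting i % 2 to m
-- allows case analysis on it.
ParitySign : ℕ → ℤ → Set
ParitySign m x = if m ≡ᵇ 0 then + 0 ℤ.< x else x ℤ.< + 0

parityLetter-sign : ∀ m k → ParitySign m (parityLetter m (suc k))
parityLetter-sign zero    k = ℤ.+<+ (s≤s z≤n)
parityLetter-sign (suc _) k = ℤ.-<+

parityLetter-unique : ∀ m k {x} → ParitySign m x → ∣ x ∣ ≡ suc k → x ≡ parityLetter m (suc k)
parityLetter-unique zero    k {+ _}       _          ∣x∣≡ = ≡.cong +_ ∣x∣≡
parityLetter-unique (suc _) k { -[1+ _ ]} _          refl = refl
parityLetter-unique (suc _) k {+ _}       (ℤ.+<+ ()) _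

topColumn-signOK : ∀ n i → SignOK (topColumn n i)
topColumn-signOK n i = parityLetter-sign (i % 2) n

signOK⇒topColumn : ∀ {n i x} → SignOK (i , x) → ∣ x ∣ ≡ suc n → (i , x) ≡ topColumn n i
signOK⇒topColumn {n} {i} sign ∣x∣≡ = ≡.cong (i ,_) (parityLetter-unique (i % 2) n sign ∣x∣≡)

neg-parityLetter : ∀ {m} k w → m < 2 → neg (parityLetter m (suc k) ∷ w) ≡ m ℕ.+ neg w
neg-parityLetter {zero}        k w _ = refl
neg-parityLetter {suc zero}    k w _ = refl
neg-parityLetter {suc (suc _)} k w (s≤s (s≤s ()))

ColumnOK : ℕ → Column → Set
ColumnOK s p = proj₁ p ≤ s × SignOK p

-- IsWSP without the order of the columns: it is invariant under permutation.
Admissible : ℕ → ℕ → List Column → Set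
Admissible n s ps = All (ColumnOK s) ps × IsSignedPerm n (map proj₂ ps)

Admissible-resp-↭ : ∀ {n s ps ps′} → ps ↭ ps′ → Admissible n s ps → Admissible n s ps′
Admissible-resp-↭ ps↭ps′ (ok , perm) = All-resp-↭ ps↭ps′ ok , IsSignedPerm-resp-↭ (Perm.map⁺ proj₂ ps↭ps′) perm

Admissible-∷ : ∀ {n s i ps} → i ≤ s → Admissible n s ps → Admissible (suc n) s (topColumn n i ∷ ps)
Admissible-∷ {n} {i = i} i≤s (ok , perm) =
  (i≤s , topColumn-signOK n i) ∷ ok , IsSignedPerm-∷ (∣parityLetter∣ (i % 2) n) perm

Admissible-∷⁻ : ∀ {n s p ps} → ∣ proj₂ p ∣ ≡ suc n → Admissible (suc n) s (p ∷ ps) →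
  p ≡ topColumn n (proj₁ p) × proj₁ p ≤ s × Admissible n s ps
Admissible-∷⁻ ∣x∣≡ ((i≤s , sign) ∷ ok , perm) =
  signOK⇒topColumn sign ∣x∣≡ , i≤s , ok , IsSignedPerm-∷⁻ ∣x∣≡ perm

topColumn∉ : ∀ {n s i ps} → Admissible n s ps → topColumn n i ∉ ps
topColumn∉ {n} {i = i} (_ , _ , letters , _) top∈ =
  ℕP.1+n≰n (≡.subst (_≤ n) (∣parityLetter∣ (i % 2) n) (proj₂ (All.lookup letters (∈-map⁺ proj₂ top∈))))

IsWSP⇒columns : ∀ {n s c w} → IsWSP n s c w → Sorted (zip c w) × Admissible n s (zip c w)
IsWSP⇒columns {n} {s} {c} {w} (|c| , c↘ , c₁≤s , perm@(|w| , _) , adj , sign) =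
  Linked.map inj₁ (Linked.zipWith ≥∧adj⇒≺ (Linkedₚ.map⁻ (≡.subst (Linked ℕ._≥_) (≡.sym c≡) c↘) , adj)) ,
  All.zip (Allₚ.map⁻ (≡.subst (All (_≤ s)) (≡.sym c≡) (headLe⇒all≤ c₁≤s c↘)) , sign) ,
  ≡.subst (IsSignedPerm n) (≡.sym w≡) perm
  where
  c≡ = proj₁ (map-proj-zip (≡.trans |c| (≡.sym |w|)))
  w≡ = proj₂ (map-proj-zip (≡.trans |c| (≡.sym |w|)))
  ≥∧adj⇒≺ : ∀ {p q} → proj₁ p ℕ.≥ proj₁ q × AdjOK p q → p ≺ q
  ≥∧adj⇒≺ (c≥c′ , adj) with ℕP.m≤n⇒m<n∨m≡n c≥c′
  ... | inj₁ c′<c = inj₁ c′<c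
  ... | inj₂ refl = inj₂ (refl , adj refl)

columns∈WSP : ∀ {n s ps} → Sorted ps → Admissible n s ps → unzip ps ∈ WSP n s
columns∈WSP {n} {s} {ps} ps↗ (ok , perm@(|w| , _ , uw)) =
  ≡.subst (_∈ WSP n s) (≡.sym (unzip≡map-proj ps)) (∈-WSP⁺
    ( ≡.trans (length-map proj₁ ps) (≡.trans (≡.sym (length-map proj₂ ps)) |w|)
    , Linkedₚ.map⁺ (Linked.map ≺⇒≥ strict)
    , headLe ok
    , perm
    , ≡.subst (Linked AdjOK) (≡.sym (zip-map-proj ps)) (Linked.map ≺⇒adj strict)
    , ≡.subst (All SignOK) (≡.sym (zip-map-proj ps)) (All.map proj₂ ok)))
  where
  strict = sorted∧unique⇒linked-≺ ps↗ (Unique.map⁻ (Unique.map⁻ uw))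
  ≺⇒≥ : ∀ {p q} → p ≺ q → proj₁ p ℕ.≥ proj₁ q
  ≺⇒≥ (inj₁ c′<c)        = ℕP.<⇒≤ c′<c
  ≺⇒≥ (inj₂ (refl , _)) = ℕP.≤-refl
  ≺⇒adj : ∀ {p q} → p ≺ q → AdjOK p q
  ≺⇒adj (inj₁ c′<c)       refl = contradiction c′<c (ℕP.<-irrefl refl)
  ≺⇒adj (inj₂ (_ , x<x′)) _    = x<x′
  headLe : ∀ {qs} → All (ColumnOK s) qs → HeadLe s (map proj₁ qs)
  headLe []             = _
  headLe ((c≤s , _) ∷ _) = c≤s

insertTop : ℕ → ℕ → List ℕ × List ℤ → List ℕ × List ℤ
insertTop n i (c , w) = unzip (insert (topColumn n i) (zip c w))

insertTop-↭ : ∀ {n s} i {c w} → (c , w) ∈ WSP n s →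
  proj₁ (insertTop n i (c , w)) ↭ i ∷ c × proj₂ (insertTop n i (c , w)) ↭ proj₂ (topColumn n i) ∷ w
insertTop-↭ {n} {s} i {c} {w} cw∈ =
  ≡.subst (λ cw → proj₁ inserted ↭ i ∷ proj₁ cw × proj₂ inserted ↭ proj₂ (topColumn n i) ∷ proj₂ cw)
    (WSP-unzip-zip {n} {s} cw∈) (unzip-↭ (insert-↭ (topColumn n i) (zip c w)))
  where inserted = insertTop n i (c , w)

insertTop-∈ : ∀ {n s i cw} → i ≤ s → cw ∈ WSP n s → insertTop n i cw ∈ WSP (suc n) s
insertTop-∈ {n} {s} {i} i≤s cw∈ with IsWSP⇒columns (∈-WSP⁻ {n} {s} cw∈)
... | ps↗ , adm = columns∈WSP (insert-↗ (topColumn n i) ps↗)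
                    (Admissible-resp-↭ (↭-sym (insert-↭ _ _)) (Admissible-∷ i≤s adm))

insertTop-injective : ∀ {n s i i′ cw cw′} → cw ∈ WSP n s → cw′ ∈ WSP n s →
  insertTop n i cw ≡ insertTop n i′ cw′ → i ≡ i′ × cw ≡ cw′
insertTop-injective {n} {s} {i} {i′} {c , w} {c′ , w′} cw∈ cw′∈ eq
  with IsWSP⇒columns (∈-WSP⁻ {n} {s} cw∈) | IsWSP⇒columns (∈-WSP⁻ {n} {s} cw′∈)
... | ps↗ , _ | ps′↗ , adm′ = ≡.cong proj₁ top≡top′ , cw≡cw′
  where
  extended : topColumn n i ∷ zip c w ↭ topColumn n i′ ∷ zip c′ w′
  extended = ↭-trans (↭-sym (insert-↭ _ _))
                     (≡.subst (_↭ _) (≡.sym (unzip-injective eq)) (insert-↭ _ _))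
  top≡top′ : topColumn n i ≡ topColumn n i′
  top≡top′ with ∈-resp-↭ extended (here refl)
  ... | here top≡top′ = top≡top′
  ... | there top∈    = contradiction top∈ (topColumn∉ adm′)
  zip↭zip′ : zip c w ↭ zip c′ w′
  zip↭zip′ = drop-∷ (≡.subst (λ t → _ ↭ t ∷ _) (≡.sym top≡top′) extended)
  cw≡cw′ : (c , w) ≡ (c′ , w′)
  cw≡cw′ = begin
    (c , w)             ≡⟨ WSP-unzip-zip {n} {s} cw∈ ⟨
    unzip (zip c w)     ≡⟨ ≡.cong unzip (sorted-↭⇒≡ ps↗ ps′↗ zip↭zip′) ⟩
    unzip (zip c′ w′)   ≡⟨ WSP-unzip-zip {n} {s} cw′∈ ⟩
    (c′ , w′)           ∎
    where open ≡.≡-Reasoning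

insertTopImage : ℕ → ℕ → List (List ℕ × List ℤ)
insertTopImage n s = map (uncurry (insertTop n)) (cartesianProduct (upTo (suc s)) (WSP n s))

WSP-suc⊆insertTopImage : ∀ {n s cw} → cw ∈ WSP (suc n) s → cw ∈ insertTopImage n s
WSP-suc⊆insertTopImage {n} {s} {c , w} cw∈
  with ps↗ , adm ← IsWSP⇒columns (∈-WSP⁻ {suc n} {s} cw∈)
  with p , p∈ , ∣p∣≡ ← find (Anyₚ.map⁻ (IsSignedPerm⇒top (proj₂ adm)))
  with as , bs , ps≡ ← ∈-∃++ p∈
  with p≡top , i≤s , adm′ ← Admissible-∷⁻ ∣p∣≡
         (Admissible-resp-↭ (≡.subst (_↭ p ∷ as ++ bs) (≡.sym ps≡) (shift p as bs)) adm)
  = ≡.subst (_∈ insertTopImage n s) inserted≡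
      (∈-map⁺ (uncurry (insertTop n)) (∈-cartesianProduct⁺ (∈-upTo⁺ (s≤s i≤s)) rest∈))
  where
  rest = sort (as ++ bs)
  top = topColumn n (proj₁ p)
  rest∈ : unzip rest ∈ WSP n s
  rest∈ = columns∈WSP (sort-↗ (as ++ bs)) (Admissible-resp-↭ (↭-sym (sort-↭ (as ++ bs))) adm′)
  insert↭ : insert top rest ↭ zip c w
  insert↭ = begin
    insert top rest     ↭⟨ insert-↭ top rest ⟩
    top ∷ rest          ↭⟨ prep top (sort-↭ (as ++ bs)) ⟩
    top ∷ as ++ bs      ≡⟨ ≡.cong (_∷ as ++ bs) p≡top ⟨
    p ∷ as ++ bs        ↭⟨ shift p as bs ⟨
    as ++ p ∷ bs        ≡⟨ ps≡ ⟨
    zip c w             ∎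
    where open PermutationReasoning
  inserted≡ : insertTop n (proj₁ p) (unzip rest) ≡ (c , w)
  inserted≡ = begin
    unzip (insert top (uncurry zip (unzip rest)))
      ≡⟨ ≡.cong (unzip ∘ insert top) (zip-unzip rest) ⟩
    unzip (insert top rest)
      ≡⟨ ≡.cong unzip (sorted-↭⇒≡ (insert-↗ top (sort-↗ (as ++ bs))) ps↗ insert↭) ⟩
    unzip (zip c w)
      ≡⟨ WSP-unzip-zip {suc n} {s} cw∈ ⟩
    (c , w) ∎
    where open ≡.≡-Reasoning

insertTopImage⊆WSP-suc : ∀ {n s cw} → cw ∈ insertTopImage n s → cw ∈ WSP (suc n) s
insertTopImage⊆WSP-suc {n} {s} cw∈
  with (i , cw′) , icw∈ , refl ← ∈-map⁻ (uncurry (insertTop n)) cw∈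
  with i∈ , cw′∈ ← ∈-cartesianProduct⁻ (upTo (suc s)) (WSP n s) icw∈
  = insertTop-∈ {n} {s} (s≤s⁻¹ (∈-upTo⁻ i∈)) cw′∈

insertTopImage-unique : ∀ n s → Unique (insertTopImage n s)
insertTopImage-unique n s =
  Unique-map⁺-∈ injective (Unique.cartesianProduct⁺ (Unique.upTo⁺ (suc s)) (WSP-unique n s))
  where
  pairs = cartesianProduct (upTo (suc s)) (WSP n s)
  injective : ∀ {x y} → x ∈ pairs → y ∈ pairs → uncurry (insertTop n) x ≡ uncurry (insertTop n) y → x ≡ y
  injective {i , cw} {i′ , cw′} x∈ y∈ eq = ≡.cong₂ _,_ (proj₁ i,cw≡) (proj₂ i,cw≡)
    where
    i,cw≡ : i ≡ i′ × cw ≡ cw′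
    i,cw≡ = insertTop-injective {n} {s} (proj₂ (∈-cartesianProduct⁻ (upTo (suc s)) (WSP n s) x∈))
                                        (proj₂ (∈-cartesianProduct⁻ (upTo (suc s)) (WSP n s) y∈)) eq

WSP-suc-↭ : ∀ n s → WSP (suc n) s ↭ insertTopImage n s
WSP-suc-↭ n s = ∼bag⇒↭ (unique∧set⇒bag (WSP-unique (suc n) s) (insertTopImage-unique n s)
  (mk⇔ (WSP-suc⊆insertTopImage {n} {s}) (insertTopImage⊆WSP-suc {n} {s})))

module Weights {a ℓ : Level} (R : CommutativeRing a ℓ) (q Z : CommutativeRing.Carrier R) where
  open CommutativeRing R hiding (refl)
  open RingSums R
  open import Algebra.Properties.CommutativeSemigroup *-commutativeSemigroup using (interchange)
  open import Relation.Binary.Reasoning.Setoid setoid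

  weight : List ℕ × List ℤ → Carrier
  weight cw = pow R q (tot (proj₁ cw)) * pow R Z (neg (proj₂ cw))

  stepWeight : ℕ → Carrier
  stepWeight i = pow R q i * pow R Z (i % 2)

  weight-insertTop : ∀ {n s} i {cw} → cw ∈ WSP n s → weight (insertTop n i cw) ≈ stepWeight i * weight cw
  weight-insertTop {n} {s} i {c , w} cw∈ = begin
    weight (insertTop n i (c , w))
      ≡⟨ ≡.cong₂ (λ t m → pow R q t * pow R Z m) tot≡ neg≡ ⟩
    pow R q (i ℕ.+ tot c) * pow R Z (i % 2 ℕ.+ neg w)
      ≈⟨ *-cong (pow-homo-* q i (tot c)) (pow-homo-* Z (i % 2) (neg w)) ⟩
    (pow R q i * pow R q (tot c)) * (pow R Z (i % 2) * pow R Z (neg w))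
      ≈⟨ interchange _ _ _ _ ⟩
    stepWeight i * weight (c , w) ∎
    where
    tot≡ : tot (proj₁ (insertTop n i (c , w))) ≡ i ℕ.+ tot c
    tot≡ = sum-↭ (proj₁ (insertTop-↭ {n} {s} i cw∈))
    neg≡ : neg (proj₂ (insertTop n i (c , w))) ≡ i % 2 ℕ.+ neg w
    neg≡ = ≡.trans (Perm.↭-length (Perm.filter-↭ (ℤ._<? ℤ.+ 0) (proj₂ (insertTop-↭ {n} {s} i cw∈))))
                   (neg-parityLetter n w (m%n<n i 2))

  wspGF-suc : ∀ n s → wspGF R q Z (suc n) s ≈ stepSum R q Z s * wspGF R q Z n s
  wspGF-suc n s = begin
    ringSum R (map weight (WSP (suc n) s))
      ≈⟨ ringSum-resp-↭ (Perm.map⁺ weight (WSP-suc-↭ n s)) ⟩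
    ringSum R (map weight (map (uncurry (insertTop n)) pairs))
      ≡⟨ ≡.cong (ringSum R) (map-∘ pairs) ⟨
    ringSum R (map (weight ∘ uncurry (insertTop n)) pairs)
      ≈⟨ ringSum-map-cong pairs (λ ic∈ →
           weight-insertTop {n} {s} _ (proj₂ (∈-cartesianProduct⁻ (upTo (suc s)) (WSP n s) ic∈))) ⟩
    ringSum R (map (λ ic → stepWeight (proj₁ ic) * weight (proj₂ ic)) pairs)
      ≈⟨ ringSum-cartesianProduct stepWeight weight (upTo (suc s)) (WSP n s) ⟩
    stepSum R q Z s * wspGF R q Z n s ∎
    where pairs = cartesianProduct (upTo (suc s)) (WSP n s)

proposition5p3 : {a ℓ : Level} (R : CommutativeRing a ℓ) (q Z : CommutativeRing.Carrier R) (s : ℕ) →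
    let open CommutativeRing R in
    (wspGF R q Z 0 s ≈ 1#)
    × ((n : ℕ) → wspGF R q Z (suc n) s - stepSum R q Z s * wspGF R q Z n s ≈ 0#)
proposition5p3 R q Z s =
  -- WSP 0 s evaluates to the single pair ([] , []).
  trans (+-identityʳ _) (*-identityˡ _) ,
  λ n → trans (+-congʳ (wspGF-suc n s)) (-‿inverseʳ _)
  where
  open CommutativeRing R hiding (refl)
  open Weights R q Z
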